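{- Let $\delta,K_1,K_2,C_0,C_1$ be admissible parameters and $M$ a magic parameter. Let $\mathbf{G}=(G,E,d)$ be a finite $\delta$-edge-labelled graph which has a completion in $\mathcal{A}^\delta_{K_1,K_2,C_0,C_1}$, let $\bar{\mathbf{G}}=(G,\bar d)$ be its completion with magic parameter $M$, and let $\mathbf{G}'=(G,d')\in\mathcal{A}^\delta_{K_1,K_2,C_0,C_1}$ be an arbitrary completion of $\mathbf{G}$. Then for every pair of vertices $u,v\in G$ such that either $\bar d(u,v)\le\min(K_1,M-1)$ or $\bar d(u,v)\ge\max(K_2,M+1)$, at least one of the following holds: (1) $\bar d(u,v)$ and $d'(u,v)$ have the same parity; (2) the parameters satisfy Case (III), $C=2\delta+K_1+1$, $C\neq 2K_1+2K_2+1$, $M>K_1>1$ and $\bar d(u,v)=K_1$.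
   Context: A $\delta$-edge-labelled graph is $(V,E,d)$ with $(V,E)$ a simple graph and $d:E\to\{1,\dots,\delta\}$; a completion of it into a class $\mathcal{K}$ of metric spaces with distances in $\{0,\dots,\delta\}$ is $(V,d')\in\mathcal{K}$ with $d'|_E=d$. Parameters $\delta,K_1,K_2,C_0,C_1$ are positive integers; acceptable if $3\le\delta<\infty$, $1\le K_1\le K_2\le\delta$, $2\delta+2\le C_0,C_1\le 3\delta+2$, $C_0$ even, $C_1$ odd. $C=\min(C_0,C_1)$, $C'=\max(C_0,C_1)$. Admissible: acceptable and either (II) $C\le 2\delta+K_1$, $C=2K_1+2K_2+1$, $K_1+K_2\ge\delta$, $K_1+2K_2\le 2\delta-1$, and either (IIA) $C'=C+1$ or (IIB) $C'>C+1$, $K_1=K_2$, $3K_2=2\delta-1$; or (III) $C\ge 2\delta+K_1+1$, $K_1+2K_2\ge 2\delta-1$, $3K_2\ge 2\delta$, if $K_1+2K_2=2\delta-1$ then $C\ge 2\delta+K_1+2$, and if $C'>C+1$ then $C\ge 2\delta+K_2$. $\mathcal{A}^\delta_{K_1,K_2,C_0,C_1}$: finite metric spaces with distances in $\{0,\dots,\delta\}$ such that for every three distinct points with perimeter $p$ and smallest distance $m$: if $p$ odd then $2K_1<p$, $p<2K_2+2m$, $p<C_1$; if $p$ even then $p<C_0$. A magic distance is $M$ with $\max(K_1,\lceil\delta/2\rceil)\le M\le\min(K_2,\lfloor(C-\delta-1)/2\rfloor)$; a magic parameter is a magic distance such that additionally: if Case (III) holds and $K_1+2K_2=2\delta-1$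 then $M>K_1$; if Case (III) holds, $C'>C+1$ and $C=2\delta+K_2$, then $M<K_2$. For $x\in\{1,\dots,\delta\}\setminus\{M\}$: $\mathcal{F}^+_x=\{(a,b)\in\{1,\dots,\delta\}^2:a+b=x\}$, $\mathcal{F}^-_x=\{(a,b):|a-b|=x\}$, $\mathcal{F}^C_x=\{(a,b):C-1-a-b=x\}$; $\mathbb{F}_M(x)=\mathcal{F}^+_x\cup\mathcal{F}^C_x$ if $x<M$, $\mathcal{F}^-_x$ if $x>M$; $t_M(x)=2x-1$ if $x<M$, $2(\delta-x)$ if $x>M$. For $\mathcal{F}\subseteq\{1,\dots,\delta\}^2$, $c$, and $\mathbf{H}=(V,E,d)$, the $(\mathcal{F},c)$-completion of $\mathbf{H}$ is the $\delta$-edge-labelled graph on $V$ whose edges are those of $\mathbf{H}$ with their labels together with every non-edge $uv$ for which there is $w$ with $uw,vw\in E$ and $(d(u,w),d(v,w))\in\mathcal{F}$, labelled $c$. The completion of $\mathbf{G}$ with magic parameter $M$: $\mathbf{G}_1=\mathbf{G}$; for $k\ge1$, $\mathbf{G}_{k+1}=\mathbf{G}_k$ if $k$ is not in the image of $t_M$, otherwise $\mathbf{G}_{k+1}$ is the $(\mathbb{F}_M(t_M^{ -1}(k)),t_M^{ -1}(k))$-completion of $\mathbf{G}_k$; in the eventual limit every remaining non-edge is labelled $M$, giving $\bar{\mathbf{G}}=(V,\bar d)$. -}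

module Defs where

open import Data.Nat using (ℕ; zero; suc; _+_; _*_; _∸_; _≤_; _<_; _⊓_; _⊔_; _%_; ⌊_/2⌋; ⌈_/2⌉; _≡ᵇ_; _<ᵇ_)
open import Data.Nat.Divisibility using (_∣_)
open import Data.Fin using (Fin)
import Data.Fin as F
open import Data.Maybe using (Maybe; just; nothing)
open import Data.Bool using (Bool; true; false; if_then_else_; _∧_; _∨_; not)
open import Data.List using (List; []; _∷_; allFin; applyUpTo)
open import Data.Bool.ListAction using (any)
open import Data.Product using (_×_; Σ)
open import Data.Sum using (_⊎_)
open import Relation.Nullary using (¬_; does)
open import Relation.Binary.PropositionalEquality using (_≡_; _≢_)

Cmin : ℕ → ℕ → ℕ
Cmin C0 C1 = C0 ⊓ C1

Cmax : ℕ → ℕ → ℕ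
Cmax C0 C1 = C0 ⊔ C1

Acceptable : (δ K1 K2 C0 C1 : ℕ) → Set
Acceptable δ K1 K2 C0 C1 =
  3 ≤ δ × 1 ≤ K1 × K1 ≤ K2 × K2 ≤ δ
  × 2 * δ + 2 ≤ C0 × C0 ≤ 3 * δ + 2
  × 2 * δ + 2 ≤ C1 × C1 ≤ 3 * δ + 2
  × 2 ∣ C0 × ¬ (2 ∣ C1)

CaseII : (δ K1 K2 C0 C1 : ℕ) → Set
CaseII δ K1 K2 C0 C1 =
  C ≤ 2 * δ + K1 × C ≡ 2 * K1 + 2 * K2 + 1 × δ ≤ K1 + K2
  × K1 + 2 * K2 ≤ 2 * δ ∸ 1
  × (C' ≡ C + 1
     ⊎ (C + 1 < C' × K1 ≡ K2 × 3 * K2 ≡ 2 * δ ∸ 1))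
  where C = Cmin C0 C1 ; C' = Cmax C0 C1

CaseIII : (δ K1 K2 C0 C1 : ℕ) → Set
CaseIII δ K1 K2 C0 C1 =
  2 * δ + K1 + 1 ≤ C × 2 * δ ∸ 1 ≤ K1 + 2 * K2 × 2 * δ ≤ 3 * K2
  × (K1 + 2 * K2 ≡ 2 * δ ∸ 1 → 2 * δ + K1 + 2 ≤ C)
  × (C + 1 < C' → 2 * δ + K2 ≤ C)
  where C = Cmin C0 C1 ; C' = Cmax C0 C1

Admissible : (δ K1 K2 C0 C1 : ℕ) → Set
Admissible δ K1 K2 C0 C1 =
  Acceptable δ K1 K2 C0 C1 × (CaseII δ K1 K2 C0 C1 ⊎ CaseIII δ K1 K2 C0 C1)

MagicDistance : (δ K1 K2 C0 C1 M : ℕ) → Set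
MagicDistance δ K1 K2 C0 C1 M =
  K1 ⊔ ⌈ δ /2⌉ ≤ M × M ≤ K2 ⊓ ⌊ (Cmin C0 C1 ∸ δ ∸ 1) /2⌋

MagicParameter : (δ K1 K2 C0 C1 M : ℕ) → Set
MagicParameter δ K1 K2 C0 C1 M =
  MagicDistance δ K1 K2 C0 C1 M
  × (CaseIII δ K1 K2 C0 C1 → K1 + 2 * K2 ≡ 2 * δ ∸ 1 → K1 < M)
  × (CaseIII δ K1 K2 C0 C1 → Cmin C0 C1 + 1 < Cmax C0 C1
       → Cmin C0 C1 ≡ 2 * δ + K2 → M < K2)

-- Finite δ-edge-labelled graphs on vertex set Fin n.
-- lab u v = just k  iff  uv is an edge with label k.

Labelling : ℕ → Set
Labelling n = Fin n → Fin n → Maybe ℕ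

record LabelledGraph (δ n : ℕ) : Set where
  field
    lab    : Labelling n
    sym    : ∀ u v → lab u v ≡ lab v u
    irrefl : ∀ u → lab u u ≡ nothing
    range  : ∀ u v k → lab u v ≡ just k → 1 ≤ k × k ≤ δ
open LabelledGraph public

Dist : ℕ → Set
Dist n = Fin n → Fin n → ℕ

IsMetricδ : (δ n : ℕ) → Dist n → Set
IsMetricδ δ n d =
  (∀ x → d x x ≡ 0) × (∀ x y → d x y ≡ 0 → x ≡ y)
  × (∀ x y → d x y ≡ d y x)
  × (∀ x y z → d x z ≤ d x y + d y z)
  × (∀ x y → d x y ≤ δ)

InA : (δ K1 K2 C0 C1 n : ℕ) → Dist n → Set
InA δ K1 K2 C0 C1 n d =
  IsMetricδ δ n d
  × (∀ x y z → x ≢ y → y ≢ z → x ≢ z →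
       let p = d x y + d y z + d x z
           m = d x y ⊓ d y z ⊓ d x z
       in (p % 2 ≡ 1 → 2 * K1 < p × p < 2 * K2 + 2 * m × p < C1)
        × (p % 2 ≡ 0 → p < C0))

IsCompletion : ∀ {δ n} → LabelledGraph δ n → Dist n → Set
IsCompletion {n = n} G d = ∀ (u v : Fin n) k → lab G u v ≡ just k → d u v ≡ k

tM : (δ M x : ℕ) → ℕ
tM δ M x = if x <ᵇ M then 2 * x ∸ 1 else 2 * (δ ∸ x)

findFirst : (ℕ → Bool) → List ℕ → Maybe ℕ
findFirst p [] = nothing
findFirst p (x ∷ xs) = if p x then just x else findFirst p xs

tMinv : (δ M k : ℕ) → Maybe ℕ
tMinv δ M k =
  findFirst (λ x → not (x ≡ᵇ M) ∧ (tM δ M x ≡ᵇ k)) (applyUpTo suc δ)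

FM : (C M x : ℕ) → ℕ → ℕ → Bool
FM C M x a b =
  if x <ᵇ M
  then ((a + b) ≡ᵇ x) ∨ ((a + b + x + 1) ≡ᵇ C)   -- F⁺_x ∪ F^C_x  (C-1-a-b = x)
  else (a ≡ᵇ (b + x)) ∨ (b ≡ᵇ (a + x))

FCompletion : ∀ {n} → (ℕ → ℕ → Bool) → ℕ → Labelling n → Labelling n
FCompletion {n} Fp c L u v with L u v
... | just k  = just k
... | nothing =
  if not (does (u F.≟ v)) ∧ any witness (allFin n) then just c else nothing
  where
  witness : Fin n → Bool
  witness w with L u w | L v w
  ... | just a | just b = Fp a b
  ... | _      | _      = false

step : ∀ {n} → (δ C M k : ℕ) → Labelling n → Labelling n
step δ C M k L with tMinv δ M k
... | nothing = L
... | just x  = FCompletion (FM C M x) x L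

-- stage j = G_{j+1}
stage : ∀ {n} → (δ C M : ℕ) → Labelling n → ℕ → Labelling n
stage δ C M L zero    = L
stage δ C M L (suc j) = step δ C M (suc j) (stage δ C M L j)

-- Ḡ: G_{2δ+1} (after which nothing changes, as t_M takes values < 2δ),
-- with every remaining non-edge labelled M and distance 0 on the diagonal.
magicCompletion : ∀ {δ n} → (C M : ℕ) → LabelledGraph δ n → Dist n
magicCompletion {δ} C M G u v with does (u F.≟ v)
... | true  = 0
... | false with stage δ C M (lab G) (2 * δ) u v
...   | just k  = k
...   | nothing = M

module Submission where

-- Every label x that the algorithm puts on a pair uv is consistent with the distance
-- y = d′(u,v) of any completion in 𝒜: y ≤ x if x < M (up to one exception in case IIB),
-- x ≤ y if x > M, and x ≡ y (mod 2) in the range of the theorem, apart from the listed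
-- exception. This is proved along the algorithm: a new label x on uv comes from a vertex w
-- whose labels a, b on uw, vw are already consistent, and the relation between a, b and x
-- (a + b = x, a + b + x + 1 = C, or |a − b| = x) together with the triangle inequality and
-- the perimeter conditions of 𝒜 on the triangle uvw transfers each property to x; an even
-- perimeter gives the parity. Pairs never labelled get M, which is outside the range.

open import Defs hiding (sym)
open import Data.Bool using (Bool; true; false; if_then_else_; not; T)
open import Data.Bool.Properties using (T-≡; T-∧; T-∨; T-not-≡)
open import Data.Empty using (⊥; ⊥-elim)
open import Data.Fin using (Fin)
import Data.Fin as F
open import Data.List using ([]; _∷_; allFin; applyUpTo)
open import Data.List.Membership.Propositional using (_∈_)
open import Data.List.Membership.Propositional.Properties using (∈-applyUpTo⁻)
open import Data.List.Relation.Unary.Any using (here; there; satisfied)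
open import Data.List.Relation.Unary.Any.Properties using (any⁻)
open import Data.Maybe using (just; nothing)
open import Data.Nat hiding (parity)
open import Data.Nat.Properties
open import Data.Nat.DivMod using (%-distribˡ-+; [m+kn]%n≡m%n; m%n<n)
open import Data.Nat.Divisibility using (_∣_; m%n≡0⇒n∣m; n∣m⇒m%n≡0)
open import Data.Nat.Tactic.RingSolver using (solve; solve-∀)
open import Data.Product using (_×_; Σ; _,_; proj₁; proj₂)
open import Data.Sum using (_⊎_; inj₁; inj₂)
open import Function using (Equivalence)
open import Relation.Nullary using (¬_; yes; no)
open import Relation.Binary.PropositionalEquality

infixl 6 _⊕_
_⊕_ : ∀ {a b c d} → a ≤ b → c ≤ d → a + c ≤ b + d
_⊕_ = +-mono-≤

≡⇒≥ : ∀ {a b} → a ≡ b → b ≤ a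
≡⇒≥ e = ≤-reflexive (sym e)

-- Linear arithmetic: add the hypotheses up to L ≤ R with _⊕_; the ring
-- solver then only has to check the identity b + L ≡ s + (a + R).
≤-by-summing : ∀ {a b L R} s → L ≤ R → b + L ≡ s + (a + R) → a ≤ b
≤-by-summing {a} {b} {L} {R} s L≤R e =
  +-cancelʳ-≤ R a b (≤-trans (≤-trans (m≤n+m (a + R) s) (≡⇒≥ e)) (+-monoʳ-≤ b L≤R))

⊥-by-summing : ∀ {L R} s → L ≤ R → L ≡ s + (1 + R) → ⊥
⊥-by-summing s L≤R e with ≤-by-summing {1} {0} s L≤R e
... | ()

m≤o∸n⇒m+n≤o′ : ∀ {m n o} → 1 ≤ m → m ≤ o ∸ n → m + n ≤ o
m≤o∸n⇒m+n≤o′ {m} {n} {o} 1≤m m≤o∸n =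
  m≤o∸n⇒m+n≤o m (<⇒≤ (m∸n≢0⇒n<m λ o∸n≡0 → <⇒≱ 1≤m (≤-trans m≤o∸n (≤-reflexive o∸n≡0)))) m≤o∸n

%2-cases : ∀ n → n % 2 ≡ 0 ⊎ n % 2 ≡ 1
%2-cases n with n % 2 | m%n<n n 2
... | 0           | _ = inj₁ refl
... | 1           | _ = inj₂ refl
... | suc (suc _) | s≤s (s≤s ())

odd⇒%2≡1 : ∀ {n} → ¬ (2 ∣ n) → n % 2 ≡ 1
odd⇒%2≡1 {n} 2∤n with %2-cases n
... | inj₁ p = ⊥-elim (2∤n (m%n≡0⇒n∣m n 2 p))
... | inj₂ p = p

%2-cong-+ : ∀ m m′ n n′ → m % 2 ≡ m′ % 2 → n % 2 ≡ n′ % 2 → (m + n) % 2 ≡ (m′ + n′) % 2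
%2-cong-+ m m′ n n′ p q = begin
  (m + n) % 2                ≡⟨ %-distribˡ-+ m n 2 ⟩
  (m % 2 + n % 2) % 2        ≡⟨ cong₂ (λ i j → (i + j) % 2) p q ⟩
  (m′ % 2 + n′ % 2) % 2      ≡⟨ %-distribˡ-+ m′ n′ 2 ⟨
  (m′ + n′) % 2              ∎
  where open ≡-Reasoning

[m+2k]%2≡m%2 : ∀ m k → (m + (k + k)) % 2 ≡ m % 2
[m+2k]%2≡m%2 m k = trans (cong (λ j → (m + j) % 2) (solve (k ∷ []))) ([m+kn]%n≡m%n m k 2)

even-sum⇒≡%2 : ∀ m n → (m + n) % 2 ≡ 0 → m % 2 ≡ n % 2
even-sum⇒≡%2 m n m+n-even with %2-cases m | %2-cases n
... | inj₁ p | inj₁ q = trans p (sym q)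
... | inj₂ p | inj₂ q = trans p (sym q)
... | inj₁ p | inj₂ q = ⊥-elim (0≢1+n (trans (sym m+n-even) (%2-cong-+ m 0 n 1 p q)))
... | inj₂ p | inj₁ q = ⊥-elim (0≢1+n (trans (sym m+n-even) (%2-cong-+ m 1 n 0 p q)))

m+2k≡2j⇒even : ∀ m k j → m + (k + k) ≡ j + j → m % 2 ≡ 0
m+2k≡2j⇒even m k j e = trans (sym ([m+2k]%2≡m%2 m k)) (trans (cong (_% 2) e) ([m+2k]%2≡m%2 0 j))

even-[2k+m]⇒even : ∀ k m → (k + k + m) % 2 ≡ 0 → m % 2 ≡ 0
even-[2k+m]⇒even k m e = trans (sym ([m+2k]%2≡m%2 m k)) (trans (cong (_% 2) (+-comm m (k + k))) e)

odd-suc⇒even : ∀ m → (m + 1) % 2 ≡ 1 → m % 2 ≡ 0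
odd-suc⇒even m m+1-odd with %2-cases m
... | inj₁ p = p
... | inj₂ p = ⊥-elim (0≢1+n (trans (sym (%2-cong-+ m 1 1 1 p refl)) m+1-odd))

[k+m+k+n]%2≡[m+n]%2 : ∀ k m n → (k + m + k + n) % 2 ≡ (m + n) % 2
[k+m+k+n]%2≡[m+n]%2 k m n = trans (cong (_% 2) (regroup k m n)) ([m+2k]%2≡m%2 (m + n) k)
  where
  regroup : ∀ k m n → k + m + k + n ≡ (m + n) + (k + k)
  regroup = solve-∀

findFirst-sound : ∀ p xs {x} → findFirst p xs ≡ just x → x ∈ xs × T (p x)
findFirst-sound p (y ∷ ys) h with p y in py
... | true with h
...   | refl = here refl , Equivalence.from T-≡ py
findFirst-sound p (y ∷ ys) h | false with findFirst-sound p ys h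
...   | x∈ys , px = there x∈ys , px

T-not-≡ᵇ⇒≢ : ∀ m n → T (not (m ≡ᵇ n)) → m ≢ n
T-not-≡ᵇ⇒≢ m n t m≡n = subst T (Equivalence.to T-not-≡ t) (≡⇒≡ᵇ m n m≡n)

tMinv-sound : ∀ δ M k {x} → tMinv δ M k ≡ just x → 1 ≤ x × x ≤ δ × x ≢ M
tMinv-sound δ M k {x} h with findFirst-sound _ (applyUpTo suc δ) h
... | x∈ , px with ∈-applyUpTo⁻ suc x∈ | Equivalence.to (T-∧ {not (x ≡ᵇ M)}) px
...   | i , i<δ , refl | x≢M , _ = s≤s z≤n , i<δ , T-not-≡ᵇ⇒≢ (suc i) M x≢M

record NewEdge {n} (Fp : ℕ → ℕ → Bool) (L : Labelling n) (u v : Fin n) : Set where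
  constructor new-edge
  field
    w    : Fin n
    a b  : ℕ
    uw   : L u w ≡ just a
    vw   : L v w ≡ just b
    Fpab : T (Fp a b)
    u≢v  : u ≢ v

if-just : ∀ {A : Set} {b : Bool} {x y : A} → (if b then just x else nothing) ≡ just y → T b × x ≡ y
if-just {b = true} refl = _ , refl

FCompletion-just : ∀ {n} Fp c (L : Labelling n) u v {k} → FCompletion Fp c L u v ≡ just k
                 → L u v ≡ just k ⊎ (k ≡ c × NewEdge Fp L u v)
FCompletion-just {n} Fp c L u v h with L u v
... | just _ = inj₁ h
... | nothing with u F.≟ v
...   | yes _ with () ← h
...   | no u≢v with if-just h
...     | any-w , refl with satisfied (any⁻ _ (allFin n) any-w)
...       | w , Fpw with L u w in uw | L v w in vw
...         | just a | just b = inj₂ (refl , new-edge w a b uw vw Fpw u≢v)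

data FMWitness (C M x a b : ℕ) : Set where
  in-F⁺  : x < M → a + b ≡ x → FMWitness C M x a b
  in-Fᶜ  : x < M → a + b + x + 1 ≡ C → FMWitness C M x a b
  in-F⁻  : M ≤ x → a ≡ b + x → FMWitness C M x a b
  in-F⁻′ : M ≤ x → b ≡ a + x → FMWitness C M x a b

FM-witness : ∀ C M x a b → T (FM C M x a b) → FMWitness C M x a b
FM-witness C M x a b t with x <ᵇ M in x<ᵇM
... | true with <ᵇ⇒< x M (subst T (sym x<ᵇM) _) | Equivalence.to T-∨ t
...   | x<M | inj₁ e = in-F⁺ x<M (≡ᵇ⇒≡ (a + b) x e)
...   | x<M | inj₂ e = in-Fᶜ x<M (≡ᵇ⇒≡ (a + b + x + 1) C e)
FM-witness C M x a b t | false with ≮⇒≥ (λ x<M → subst T x<ᵇM (<⇒<ᵇ x<M)) | Equivalence.to T-∨ t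
...   | M≤x | inj₁ e = in-F⁻ M≤x (≡ᵇ⇒≡ a (b + x) e)
...   | M≤x | inj₂ e = in-F⁻′ M≤x (≡ᵇ⇒≡ b (a + x) e)

-- C and C′ are abstracted from C0 ⊓ C1 and C0 ⊔ C1 so that the ring solver treats them as atoms.
module Parameters (δ K1 K2 C0 C1 M C C′ : ℕ) (C-def : C0 ⊓ C1 ≡ C) (C′-def : C0 ⊔ C1 ≡ C′)
                  (adm : Admissible δ K1 K2 C0 C1) (mag : MagicParameter δ K1 K2 C0 C1 M) where

  3≤δ : 3 ≤ δ
  3≤δ = let (h , _) = proj₁ adm in h

  1≤K1 : 1 ≤ K1
  1≤K1 = let (_ , h , _) = proj₁ adm in h

  C0-even : C0 % 2 ≡ 0
  C0-even = let (_ , _ , _ , _ , _ , _ , _ , _ , h , _) = proj₁ adm in n∣m⇒m%n≡0 C0 2 h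

  C1-odd : C1 % 2 ≡ 1
  C1-odd = let (_ , _ , _ , _ , _ , _ , _ , _ , _ , h) = proj₁ adm in odd⇒%2≡1 h

  K1≤M : K1 ≤ M
  K1≤M = m⊔n≤o⇒m≤o K1 _ (proj₁ (proj₁ mag))

  M≤K2 : M ≤ K2
  M≤K2 = m≤n⊓o⇒m≤n K2 _ (proj₂ (proj₁ mag))

  1≤M : 1 ≤ M
  1≤M = ≤-trans 1≤K1 K1≤M

  δ≤2M : δ ≤ M + M
  δ≤2M = begin
    δ                   ≡⟨ ⌊n/2⌋+⌈n/2⌉≡n δ ⟨
    ⌊ δ /2⌋ + ⌈ δ /2⌉   ≤⟨ +-monoˡ-≤ _ (⌊n/2⌋≤⌈n/2⌉ δ) ⟩
    ⌈ δ /2⌉ + ⌈ δ /2⌉   ≤⟨ ⌈δ/2⌉≤M ⊕ ⌈δ/2⌉≤M ⟩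
    M + M               ∎
    where
    open ≤-Reasoning
    ⌈δ/2⌉≤M = m⊔n≤o⇒n≤o K1 _ (proj₁ (proj₁ mag))

  2M+δ+1≤C : M + M + δ + 1 ≤ C
  2M+δ+1≤C = begin
    M + M + δ + 1       ≡⟨ solve (M ∷ δ ∷ []) ⟩
    (M + M) + 1 + δ     ≤⟨ m≤o∸n⇒m+n≤o′ (m≤n+m 1 (M + M)) (m≤o∸n⇒m+n≤o′ (≤-trans 1≤M (m≤m+n M M)) 2M≤q) ⟩
    C0 ⊓ C1             ≡⟨ C-def ⟩
    C                   ∎
    where
    open ≤-Reasoning
    q = C0 ⊓ C1 ∸ δ ∸ 1
    M≤⌊q/2⌋ = m≤n⊓o⇒m≤o K2 _ (proj₂ (proj₁ mag))
    2M≤q : M + M ≤ q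
    2M≤q = ≤-trans (M≤⌊q/2⌋ ⊕ M≤⌊q/2⌋)
             (≤-trans (+-monoʳ-≤ _ (⌊n/2⌋≤⌈n/2⌉ q)) (≤-reflexive (⌊n/2⌋+⌈n/2⌉≡n q)))

  C≡C0⊎C≡C1 : C ≡ C0 ⊎ C ≡ C1
  C≡C0⊎C≡C1 with ⊓-sel C0 C1
  ... | inj₁ e = inj₁ (trans (sym C-def) e)
  ... | inj₂ e = inj₂ (trans (sym C-def) e)

  odd-C≡C1 : C % 2 ≡ 1 → C ≡ C1
  odd-C≡C1 C-odd with C≡C0⊎C≡C1
  ... | inj₂ e = e
  ... | inj₁ e = ⊥-elim (0≢1+n (trans (sym C0-even) (trans (cong (_% 2) (sym e)) C-odd)))

  2δ∸1+1≡2δ : 2 * δ ∸ 1 + 1 ≡ 2 * δ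
  2δ∸1+1≡2δ = m∸n+n≡m (≤-trans (s≤s z≤n) (≤-trans 3≤δ (m≤m+n δ (δ + 0))))

  module _ (ii : CaseII δ K1 K2 C0 C1) where
    II-C≤ : C ≤ 2 * δ + K1
    II-C≤ = ≤-trans (≡⇒≥ C-def) (proj₁ ii)

    II-C≡ : C ≡ 2 * K1 + 2 * K2 + 1
    II-C≡ = let (_ , h , _) = ii in trans (sym C-def) h

    II-δ≤ : δ ≤ K1 + K2
    II-δ≤ = let (_ , _ , h , _) = ii in h

    IIA⊎IIB : C′ ≡ C + 1 ⊎ (C + 1 < C′ × K1 ≡ K2 × 3 * K2 + 1 ≡ 2 * δ)
    IIA⊎IIB with proj₂ (proj₂ (proj₂ (proj₂ ii)))
    ... | inj₁ e = inj₁ (trans (sym C′-def) (trans e (cong (_+ 1) C-def)))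
    ... | inj₂ (h , k , e) =
      inj₂ (subst₂ (λ c c′ → c + 1 < c′) C-def C′-def h , k , trans (cong (_+ 1) e) 2δ∸1+1≡2δ)

  module _ (iii : CaseIII δ K1 K2 C0 C1) where
    III-C≥ : 2 * δ + K1 + 1 ≤ C
    III-C≥ = ≤-trans (proj₁ iii) (≤-reflexive C-def)

    III-2δ≤ : 2 * δ ≤ K1 + 2 * K2 + 1
    III-2δ≤ = let (_ , h , _) = iii in ≤-trans (≡⇒≥ 2δ∸1+1≡2δ) (+-monoˡ-≤ 1 h)

    III-C′ : C + 1 < C′ → 2 * δ + K2 ≤ C
    III-C′ h = let (_ , _ , _ , _ , f) = iii in
      ≤-trans (f (subst₂ (λ c c′ → c + 1 < c′) (sym C-def) (sym C′-def) h)) (≤-reflexive C-def)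

    III-M<K2 : C + 1 < C′ → C ≡ 2 * δ + K2 → M < K2
    III-M<K2 h e = proj₂ (proj₂ mag) iii (subst₂ (λ c c′ → c + 1 < c′) (sym C-def) (sym C′-def) h) (trans C-def e)

  ¬II×III : CaseII δ K1 K2 C0 C1 → CaseIII δ K1 K2 C0 C1 → ⊥
  ¬II×III ii iii = ⊥-by-summing 0 (II-C≤ ii ⊕ III-C≥ iii) (solve (δ ∷ K1 ∷ C ∷ []))

  2K1+2K2+1-odd : C ≡ 2 * K1 + 2 * K2 + 1 → C % 2 ≡ 1
  2K1+2K2+1-odd C≡ = trans (cong (_% 2) (trans C≡ (regroup K1 K2))) ([m+2k]%2≡m%2 1 (K1 + K2))
    where
    regroup : ∀ m n → 2 * m + 2 * n + 1 ≡ 1 + ((m + n) + (m + n))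
    regroup = solve-∀

  record PerimeterCondition (p m : ℕ) : Set where
    constructor perimeter-condition
    field
      when-odd  : p % 2 ≡ 1 → 2 * K1 < p × p < 2 * K2 + 2 * m × p < C1
      when-even : p % 2 ≡ 0 → p < C0
  open PerimeterCondition

  perimeter<C′ : ∀ {p m} → PerimeterCondition p m → p < C′
  perimeter<C′ {p} (perimeter-condition odd-cond even-cond) with %2-cases p
  ... | inj₁ e = ≤-trans (even-cond e) (≤-trans (m≤m⊔n C0 C1) (≤-reflexive C′-def))
  ... | inj₂ o = ≤-trans (proj₂ (proj₂ (odd-cond o))) (≤-trans (m≤n⊔m C0 C1) (≤-reflexive C′-def))

  perimeter≢C : ∀ {p m} → PerimeterCondition p m → p ≢ C
  perimeter≢C (perimeter-condition odd-cond even-cond) refl with C≡C0⊎C≡C1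
  ... | inj₁ e = <-irrefl e (even-cond (trans (cong (_% 2) e) C0-even))
  ... | inj₂ e = <-irrefl e (proj₂ (proj₂ (odd-cond (trans (cong (_% 2) e) C1-odd))))

  ParityRange : ℕ → Set
  ParityRange x = x ≤ K1 ⊓ (M ∸ 1) ⊎ K2 ⊔ suc M ≤ x

  low-range : ∀ {x} → x ≤ K1 → x < M → ParityRange x
  low-range {x} x≤K1 x<M = inj₁ (⊓-glb x≤K1 (m+n≤o⇒m≤o∸n x (subst (_≤ M) (+-comm 1 x) x<M)))

  high-range : ∀ {x} → K2 ≤ x → M < x → ParityRange x
  high-range K2≤x M<x = inj₂ (⊔-lub K2≤x M<x)

  Exception : ℕ → Set
  Exception x = CaseIII δ K1 K2 C0 C1
              × C ≡ 2 * δ + K1 + 1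
              × C ≢ 2 * K1 + 2 * K2 + 1
              × K1 < M × 1 < K1
              × x ≡ K1

  exception-K1 : ∀ {x} → Exception x → x ≡ K1
  exception-K1 (_ , _ , _ , _ , _ , e) = e

  IIBException : ℕ → ℕ → Set
  IIBException x y = CaseII δ K1 K2 C0 C1 × C + 1 < C′ × suc x ≡ M × x % 2 ≡ y % 2

  -- The invariant of the algorithm, for a label x of uv and y = d′(u,v) in a completion in 𝒜.
  record Consistent (x y : ℕ) : Set where
    field
      label-pos : 1 ≤ x
      label-≤δ  : x ≤ δ
      below-M   : x < M → y ≤ x ⊎ IIBException x y
      above-M   : M < x → x ≤ y
      parity-agrees : ParityRange x → x % 2 ≡ y % 2 ⊎ Exception x
  open Consistent public

  consistent-refl : ∀ {x} → 1 ≤ x → x ≤ δ → Consistent x x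
  consistent-refl 1≤x x≤δ = record
    { label-pos = 1≤x ; label-≤δ = x≤δ
    ; below-M = λ _ → inj₁ ≤-refl ; above-M = λ _ → ≤-refl ; parity-agrees = λ _ → inj₁ refl }

  module F⁺-step (x a b ya yb y : ℕ) (1≤x : 1 ≤ x) (x≤δ : x ≤ δ) (x<M : x < M) (a+b≡x : a + b ≡ x)
                 (Ca : Consistent a ya) (Cb : Consistent b yb)
                 (y≤ya+yb : y ≤ ya + yb) (P : PerimeterCondition (ya + yb + y) (ya ⊓ yb ⊓ y)) where

    module Summand (s t ys : ℕ) (s+t≡x : s + t ≡ x) (1≤t : 1 ≤ t) (Cs : Consistent s ys) where
      s<x : s < x
      s<x = ≤-by-summing 0 (1≤t ⊕ ≤-reflexive s+t≡x) (solve (s ∷ t ∷ x ∷ []))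

      ys≤s : ys ≤ s
      ys≤s with below-M Cs (<-trans s<x x<M)
      ... | inj₁ h = h
      ... | inj₂ (_ , _ , 1+s≡M , _) = ⊥-elim (<-irrefl 1+s≡M (≤-<-trans s<x x<M))

      same-parity : x ≤ K1 → s % 2 ≡ ys % 2
      same-parity x≤K1 with parity-agrees Cs (low-range (<⇒≤ s<K1) (<-trans s<x x<M))
        where s<K1 = <-≤-trans s<x x≤K1
      ... | inj₁ q = q
      ... | inj₂ e = ⊥-elim (<-irrefl (exception-K1 e) (<-≤-trans s<x x≤K1))

    module A = Summand a b ya a+b≡x (label-pos Cb) Ca
    module B = Summand b a yb (trans (+-comm b a) a+b≡x) (label-pos Ca) Cb

    y≤x : y ≤ x
    y≤x = ≤-trans y≤ya+yb (≤-trans (A.ys≤s ⊕ B.ys≤s) (≤-reflexive a+b≡x))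

    -- An odd perimeter would exceed 2 K1, but it is at most 2 (ya + yb) ≤ 2 x.
    perimeter-even : x ≤ K1 → (ya + yb + y) % 2 ≡ 0
    perimeter-even x≤K1 with %2-cases (ya + yb + y)
    ... | inj₁ ev = ev
    ... | inj₂ odd = ⊥-elim (⊥-by-summing 0
            (proj₁ (when-odd P odd) ⊕ y≤ya+yb ⊕ A.ys≤s ⊕ A.ys≤s ⊕ B.ys≤s ⊕ B.ys≤s
              ⊕ ≤-reflexive a+b≡x ⊕ ≤-reflexive a+b≡x ⊕ x≤K1 ⊕ x≤K1)
            (solve (K1 ∷ ya ∷ yb ∷ y ∷ a ∷ b ∷ x ∷ [])))

    same-parity : x ≤ K1 → x % 2 ≡ y % 2
    same-parity x≤K1 = even-sum⇒≡%2 x y (begin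
      (x + y) % 2          ≡⟨ cong (λ t → (t + y) % 2) a+b≡x ⟨
      (a + b + y) % 2      ≡⟨ %2-cong-+ (a + b) (ya + yb) y y (%2-cong-+ a ya b yb (A.same-parity x≤K1) (B.same-parity x≤K1)) refl ⟩
      (ya + yb + y) % 2    ≡⟨ perimeter-even x≤K1 ⟩
      0                    ∎)
      where open ≡-Reasoning

    consistent : Consistent x y
    consistent = record
      { label-pos = 1≤x ; label-≤δ = x≤δ
      ; below-M = λ _ → inj₁ y≤x
      ; above-M = λ M<x → ⊥-elim (<-asym x<M M<x)
      ; parity-agrees = λ { (inj₁ h) → inj₁ (same-parity (m≤n⊓o⇒m≤n K1 _ h))
                          ; (inj₂ h) → ⊥-elim (<-asym x<M (m⊔n≤o⇒n≤o K2 _ h)) } }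

  module Fᶜ-step (x a b ya yb y : ℕ) (1≤x : 1 ≤ x) (x≤δ : x ≤ δ) (x<M : x < M)
                 (a+b+x+1≡C : a + b + x + 1 ≡ C)
                 (Ca : Consistent a ya) (Cb : Consistent b yb)
                 (ya≤δ : ya ≤ δ) (yb≤δ : yb ≤ δ) (1≤y : 1 ≤ y)
                 (P : PerimeterCondition (ya + yb + y) (ya ⊓ yb ⊓ y)) where

    module Side (s t ys : ℕ) (s+t+x+1≡C : s + t + x + 1 ≡ C) (t≤δ : t ≤ δ)
                (Cs : Consistent s ys) (ys≤δ : ys ≤ δ) where
      M<s : M < s
      M<s = ≤-by-summing 0 (2M+δ+1≤C ⊕ ≡⇒≥ s+t+x+1≡C ⊕ t≤δ ⊕ x<M) (solve (s ∷ t ∷ x ∷ M ∷ δ ∷ C ∷ []))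

      s≤ys : s ≤ ys
      s≤ys = above-M Cs M<s

      ys≡δ : δ ≤ s → ys ≡ δ
      ys≡δ δ≤s = ≤-antisym ys≤δ (≤-trans δ≤s s≤ys)

      II-K2≤s : CaseII δ K1 K2 C0 C1 → x ≤ K1 → K2 ≤ s
      II-K2≤s ii x≤K1 = ≤-by-summing 0 (≡⇒≥ (II-C≡ ii) ⊕ ≡⇒≥ s+t+x+1≡C ⊕ t≤δ ⊕ II-δ≤ ii ⊕ x≤K1)
                          (solve (s ∷ t ∷ x ∷ C ∷ δ ∷ K1 ∷ K2 ∷ []))

      II-same-parity : CaseII δ K1 K2 C0 C1 → x ≤ K1 → s % 2 ≡ ys % 2
      II-same-parity ii x≤K1 with parity-agrees Cs (high-range (II-K2≤s ii x≤K1) M<s)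
      ... | inj₁ q = q
      ... | inj₂ e = ⊥-elim (¬II×III ii (proj₁ e))

      III-δ≤s : CaseIII δ K1 K2 C0 C1 → x ≤ K1 → δ ≤ s
      III-δ≤s iii x≤K1 = ≤-by-summing 0 (≡⇒≥ s+t+x+1≡C ⊕ III-C≥ iii ⊕ t≤δ ⊕ x≤K1)
                           (solve (s ∷ t ∷ x ∷ C ∷ δ ∷ K1 ∷ []))

      IIB-δ≤s : K1 ≡ K2 → 3 * K2 + 1 ≡ 2 * δ → C ≡ 2 * K1 + 2 * K2 + 1 → δ ≤ s
      IIB-δ≤s K1≡K2 3K2+1≡2δ C≡ = ≤-by-summing 0
        (≡⇒≥ s+t+x+1≡C ⊕ ≡⇒≥ C≡ ⊕ t≤δ ⊕ ≡⇒≥ 3K2+1≡2δ ⊕ x<M ⊕ M≤K2 ⊕ ≡⇒≥ K1≡K2 ⊕ ≡⇒≥ K1≡K2)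
        (solve (s ∷ t ∷ M ∷ K1 ∷ K2 ∷ C ∷ δ ∷ x ∷ []))

    module A = Side a b ya a+b+x+1≡C (label-≤δ Cb) Ca ya≤δ
    module B = Side b a yb (trans (cong (λ z → z + x + 1) (+-comm b a)) a+b+x+1≡C) (label-≤δ Ca) Cb yb≤δ

    C≤2δ+x+1 : C ≤ 2 * δ + x + 1
    C≤2δ+x+1 = ≤-by-summing 0 (≡⇒≥ a+b+x+1≡C ⊕ label-≤δ Ca ⊕ label-≤δ Cb)
                 (solve (a ∷ b ∷ x ∷ δ ∷ C ∷ []))

    a+b+x-even : C % 2 ≡ 1 → (a + b + x) % 2 ≡ 0
    a+b+x-even C-odd = odd-suc⇒even (a + b + x) (subst (λ c → c % 2 ≡ 1) (sym a+b+x+1≡C) C-odd)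

    -- If y > x the perimeter is ≥ a + b + x + 1 = C; being ≠ C, it lies strictly between C and C′.
    C+1<C′ : x < y → C + 1 < C′
    C+1<C′ x<y = ≤-by-summing 0 (C<p ⊕ perimeter<C′ P) (solve (C ∷ C′ ∷ ya ∷ yb ∷ y ∷ []))
      where
      C≤p : C ≤ ya + yb + y
      C≤p = ≤-by-summing 0 (≡⇒≥ a+b+x+1≡C ⊕ A.s≤ys ⊕ B.s≤ys ⊕ x<y)
              (solve (a ∷ b ∷ x ∷ ya ∷ yb ∷ y ∷ C ∷ []))
      C<p : C < ya + yb + y
      C<p = ≤∧≢⇒< C≤p (λ e → perimeter≢C P (sym e))

    ¬III : CaseIII δ K1 K2 C0 C1 → x < y → ⊥
    ¬III iii x<y = <⇒≱ (III-M<K2 iii (C+1<C′ x<y) C≡2δ+K2) K2≤M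
      where
      2δ+K2≤C = III-C′ iii (C+1<C′ x<y)
      K2≤M : K2 ≤ M
      K2≤M = ≤-by-summing 0 (2δ+K2≤C ⊕ C≤2δ+x+1 ⊕ x<M) (solve (δ ∷ K2 ∷ C ∷ x ∷ M ∷ []))
      C≡2δ+K2 : C ≡ 2 * δ + K2
      C≡2δ+K2 = ≤-antisym (≤-by-summing 0 (C≤2δ+x+1 ⊕ x<M ⊕ M≤K2) (solve (δ ∷ K2 ∷ C ∷ x ∷ M ∷ [])))
                          2δ+K2≤C

    IIB-exception : CaseII δ K1 K2 C0 C1 → K1 ≡ K2 → 3 * K2 + 1 ≡ 2 * δ → x < y → IIBException x y
    IIB-exception ii K1≡K2 3K2+1≡2δ x<y = ii , C+1<C′ x<y , ≤-antisym x<M M≤1+x , trans x-even (sym y-even)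
      where
      C≡ = II-C≡ ii
      M≤1+x : M ≤ suc x
      M≤1+x = ≤-by-summing 0 (M≤K2 ⊕ ≡⇒≥ C≡ ⊕ C≤2δ+x+1 ⊕ ≡⇒≥ 3K2+1≡2δ ⊕ ≡⇒≥ K1≡K2 ⊕ ≡⇒≥ K1≡K2)
                (solve (M ∷ K1 ∷ K2 ∷ C ∷ δ ∷ x ∷ []))
      δ≤a = A.IIB-δ≤s K1≡K2 3K2+1≡2δ C≡
      δ≤b = B.IIB-δ≤s K1≡K2 3K2+1≡2δ C≡
      ya≡δ = A.ys≡δ δ≤a
      yb≡δ = B.ys≡δ δ≤b
      x-even : x % 2 ≡ 0
      x-even = even-[2k+m]⇒even δ x (subst₂ (λ s t → (s + t + x) % 2 ≡ 0)
                 (≤-antisym (label-≤δ Ca) δ≤a) (≤-antisym (label-≤δ Cb) δ≤b) (a+b+x-even (2K1+2K2+1-odd C≡)))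
      -- An odd perimeter 2δ + y would be < C1 = C ≤ 2δ + x + 1 ≤ 2δ + y.
      perimeter-even : (ya + yb + y) % 2 ≡ 0
      perimeter-even with %2-cases (ya + yb + y)
      ... | inj₁ ev = ev
      ... | inj₂ odd = ⊥-elim (⊥-by-summing 0 (≡⇒≥ ya≡δ ⊕ ≡⇒≥ yb≡δ ⊕ p<C ⊕ C≤2δ+x+1 ⊕ x<y)
                                 (solve (ya ∷ yb ∷ y ∷ δ ∷ C ∷ x ∷ [])))
        where
        p<C : ya + yb + y < C
        p<C = subst (ya + yb + y <_) (sym (odd-C≡C1 (2K1+2K2+1-odd C≡))) (proj₂ (proj₂ (when-odd P odd)))
      y-even : y % 2 ≡ 0
      y-even = even-[2k+m]⇒even δ y (subst₂ (λ s t → (s + t + y) % 2 ≡ 0) ya≡δ yb≡δ perimeter-even)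

    y≤x⊎IIB : y ≤ x ⊎ IIBException x y
    y≤x⊎IIB with y ≤? x
    ... | yes y≤x = inj₁ y≤x
    ... | no y≰x with proj₂ adm
    ...   | inj₂ iii = ⊥-elim (¬III iii (≰⇒> y≰x))
    ...   | inj₁ ii with IIA⊎IIB ii
    ...     | inj₁ C′≡C+1 = ⊥-elim (<-irrefl (sym C′≡C+1) (C+1<C′ (≰⇒> y≰x)))
    ...     | inj₂ (_ , K1≡K2 , 3K2+1≡2δ) = inj₂ (IIB-exception ii K1≡K2 3K2+1≡2δ (≰⇒> y≰x))

    II-same-parity : CaseII δ K1 K2 C0 C1 → x ≤ K1 → y ≤ x → x % 2 ≡ y % 2
    II-same-parity ii x≤K1 y≤x =
      trans (sym (even-sum⇒≡%2 (a + b) x (a+b+x-even (2K1+2K2+1-odd (II-C≡ ii))))) (even-sum⇒≡%2 (a + b) y a+b+y-even)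
      where
      -- An odd perimeter would be < 2 K2 + 2y, but it is ≥ a + b + y = 2 K1 + 2 K2 − x + y ≥ 2 K2 + 2y.
      perimeter-even : (ya + yb + y) % 2 ≡ 0
      perimeter-even with %2-cases (ya + yb + y)
      ... | inj₁ ev = ev
      ... | inj₂ odd = ⊥-elim (too-small (ya ⊓ yb ⊓ y) (m⊓n≤n (ya ⊓ yb) y) (proj₁ (proj₂ (when-odd P odd))))
        where
        too-small : ∀ m → m ≤ y → ya + yb + y < 2 * K2 + 2 * m → ⊥
        too-small m m≤y p< = ⊥-by-summing 0
          (p< ⊕ m≤y ⊕ m≤y ⊕ A.s≤ys ⊕ B.s≤ys ⊕ ≡⇒≥ a+b+x+1≡C ⊕ ≡⇒≥ (II-C≡ ii) ⊕ y≤x ⊕ x≤K1 ⊕ x≤K1)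
          (solve (ya ∷ yb ∷ y ∷ m ∷ a ∷ b ∷ C ∷ K1 ∷ K2 ∷ x ∷ []))
      a+b+y-even : (a + b + y) % 2 ≡ 0
      a+b+y-even = trans (%2-cong-+ (a + b) (ya + yb) y y
                            (%2-cong-+ a ya b yb (A.II-same-parity ii x≤K1) (B.II-same-parity ii x≤K1)) refl)
                         perimeter-even

    module III-low (iii : CaseIII δ K1 K2 C0 C1) (x≤K1 : x ≤ K1) where
      x≡K1 : x ≡ K1
      x≡K1 = ≤-antisym x≤K1 (≤-by-summing 0 (III-C≥ iii ⊕ C≤2δ+x+1) (solve (δ ∷ K1 ∷ C ∷ x ∷ [])))

      C≡2δ+K1+1 : C ≡ 2 * δ + K1 + 1
      C≡2δ+K1+1 = ≤-antisym (≤-by-summing 0 (C≤2δ+x+1 ⊕ x≤K1) (solve (δ ∷ K1 ∷ C ∷ x ∷ [])))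
                            (III-C≥ iii)

      ya≡δ = A.ys≡δ (A.III-δ≤s iii x≤K1)
      yb≡δ = B.ys≡δ (B.III-δ≤s iii x≤K1)

      same-parity : C ≡ 2 * K1 + 2 * K2 + 1 → y ≤ x → x % 2 ≡ y % 2
      same-parity C≡ y≤x = trans x-even (sym y-even)
        where
        K1+2K2≡2δ : K1 + (K2 + K2) ≡ δ + δ
        K1+2K2≡2δ = ≤-antisym
          (≤-by-summing 0 (≡⇒≥ C≡ ⊕ ≤-reflexive C≡2δ+K1+1) (solve (C ∷ K1 ∷ K2 ∷ δ ∷ [])))
          (≤-by-summing 0 (≡⇒≥ C≡2δ+K1+1 ⊕ ≤-reflexive C≡) (solve (C ∷ K1 ∷ K2 ∷ δ ∷ [])))
        x-even : x % 2 ≡ 0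
        x-even = subst (λ z → z % 2 ≡ 0) (sym x≡K1) (m+2k≡2j⇒even K1 K2 δ K1+2K2≡2δ)
        -- An odd perimeter 2δ + y = K1 + 2 K2 + y would be < 2 K2 + 2y, i.e. K1 < y ≤ x.
        perimeter-even : (ya + yb + y) % 2 ≡ 0
        perimeter-even with %2-cases (ya + yb + y)
        ... | inj₁ ev = ev
        ... | inj₂ odd = ⊥-elim (too-small (ya ⊓ yb ⊓ y) (m⊓n≤n (ya ⊓ yb) y) (proj₁ (proj₂ (when-odd P odd))))
          where
          too-small : ∀ m → m ≤ y → ya + yb + y < 2 * K2 + 2 * m → ⊥
          too-small m m≤y p< = ⊥-by-summing 0
            (p< ⊕ m≤y ⊕ m≤y ⊕ ≡⇒≥ ya≡δ ⊕ ≡⇒≥ yb≡δ ⊕ ≡⇒≥ C≡ ⊕ ≤-reflexive C≡2δ+K1+1 ⊕ y≤x ⊕ x≤K1)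
            (solve (ya ∷ yb ∷ y ∷ m ∷ C ∷ K1 ∷ K2 ∷ x ∷ δ ∷ []))
        y-even : y % 2 ≡ 0
        y-even = even-[2k+m]⇒even δ y (subst₂ (λ s t → (s + t + y) % 2 ≡ 0) ya≡δ yb≡δ perimeter-even)

      parity : y ≤ x → x % 2 ≡ y % 2 ⊎ Exception x
      parity y≤x with C ≟ 2 * K1 + 2 * K2 + 1
      ... | yes C≡ = inj₁ (same-parity C≡ y≤x)
      ... | no C≢ with 1 <? K1
      ...   | yes 1<K1 = inj₂ (iii , C≡2δ+K1+1 , C≢ , subst (_< M) x≡K1 x<M , 1<K1 , x≡K1)
      ...   | no 1≮K1 = inj₁ (cong (_% 2) (≤-antisym x≤y y≤x))
        where
        x≤y : x ≤ y
        x≤y = ≤-by-summing 0 (≮⇒≥ 1≮K1 ⊕ x≤K1 ⊕ 1≤y) (solve (K1 ∷ x ∷ y ∷ []))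

    consistent : Consistent x y
    consistent = record
      { label-pos = 1≤x ; label-≤δ = x≤δ
      ; below-M = λ _ → y≤x⊎IIB
      ; above-M = λ M<x → ⊥-elim (<-asym x<M M<x)
      ; parity-agrees = parity }
      where
      parity : ParityRange x → x % 2 ≡ y % 2 ⊎ Exception x
      parity (inj₂ h) = ⊥-elim (<-asym x<M (m⊔n≤o⇒n≤o K2 _ h))
      parity (inj₁ h) with y≤x⊎IIB | proj₂ adm
      ... | inj₂ (_ , _ , _ , x≡y) | _        = inj₁ x≡y
      ... | inj₁ y≤x               | inj₁ ii  = inj₁ (II-same-parity ii (m≤n⊓o⇒m≤n K1 _ h) y≤x)
      ... | inj₁ y≤x               | inj₂ iii = III-low.parity iii (m≤n⊓o⇒m≤n K1 _ h) y≤x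

  module F⁻-step (x A B yA yB y : ℕ) (1≤x : 1 ≤ x) (x≤δ : x ≤ δ) (M<x : M < x) (A≡B+x : A ≡ B + x)
                 (CA : Consistent A yA) (CB : Consistent B yB)
                 (yA≤y+yB : yA ≤ y + yB) (P : PerimeterCondition (yA + yB + y) (yA ⊓ yB ⊓ y)) where

    M<A : M < A
    M<A = ≤-by-summing 1 (M<x ⊕ label-pos CB ⊕ ≡⇒≥ A≡B+x) (solve (M ∷ A ∷ B ∷ x ∷ []))

    B+x≤δ : B + x ≤ δ
    B+x≤δ = subst (_≤ δ) A≡B+x (label-≤δ CA)

    B<M : B < M
    B<M = ≤-by-summing 0 (B+x≤δ ⊕ M<x ⊕ δ≤2M) (solve (M ∷ B ∷ x ∷ δ ∷ []))

    A≤yA : A ≤ yA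
    A≤yA = above-M CA M<A

    -- In case IIB, B + 1 = M ≥ K2 would give 6 K2 ≤ 3 (B + 1 + M) ≤ 3δ, i.e. 4δ − 2 ≤ 3δ, against δ ≥ 3.
    yB≤B : yB ≤ B
    yB≤B with below-M CB B<M
    ... | inj₁ h = h
    ... | inj₂ (ii , C+1<C′ , 1+B≡M , _) with IIA⊎IIB ii
    ...   | inj₁ C′≡C+1 = ⊥-elim (<-irrefl (sym C′≡C+1) C+1<C′)
    ...   | inj₂ (_ , K1≡K2 , 3K2+1≡2δ) = ⊥-elim (⊥-by-summing 0
            (B+x≤δ ⊕ B+x≤δ ⊕ B+x≤δ ⊕ M<x ⊕ M<x ⊕ M<x ⊕ ≡⇒≥ 1+B≡M ⊕ ≡⇒≥ 1+B≡M ⊕ ≡⇒≥ 1+B≡M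
              ⊕ ≡⇒≥ K1≡K2 ⊕ ≡⇒≥ K1≡K2 ⊕ ≡⇒≥ K1≡K2 ⊕ ≡⇒≥ K1≡K2 ⊕ ≡⇒≥ K1≡K2 ⊕ ≡⇒≥ K1≡K2
              ⊕ K1≤M ⊕ K1≤M ⊕ K1≤M ⊕ K1≤M ⊕ K1≤M ⊕ K1≤M ⊕ ≡⇒≥ 3K2+1≡2δ ⊕ ≡⇒≥ 3K2+1≡2δ ⊕ 3≤δ)
            (solve (B ∷ x ∷ M ∷ δ ∷ K1 ∷ K2 ∷ [])))

    x≤y : x ≤ y
    x≤y = ≤-by-summing 0 (yA≤y+yB ⊕ A≤yA ⊕ ≡⇒≥ A≡B+x ⊕ yB≤B) (solve (y ∷ yA ∷ yB ∷ A ∷ B ∷ x ∷ []))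

    module High (K2≤x : K2 ≤ x) where
      A-parity : A % 2 ≡ yA % 2
      A-parity with parity-agrees CA (high-range (≤-trans K2≤x (≤-trans (m≤n+m x B) (≡⇒≥ A≡B+x))) M<A)
      ... | inj₁ q = q
      ... | inj₂ e = ⊥-elim (<⇒≱ M<A (subst (_≤ M) (sym (exception-K1 e)) K1≤M))

      B≤K1 : B ≤ K1
      B≤K1 with proj₂ adm
      ... | inj₁ ii = ≤-by-summing 0 (B+x≤δ ⊕ K2≤x ⊕ II-δ≤ ii) (solve (B ∷ x ∷ δ ∷ K1 ∷ K2 ∷ []))
      ... | inj₂ iii = ≤-by-summing 0 (B+x≤δ ⊕ B+x≤δ ⊕ K2≤x ⊕ K2≤x ⊕ label-pos CB ⊕ III-2δ≤ iii)
                         (solve (B ∷ x ∷ δ ∷ K1 ∷ K2 ∷ []))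

      B-parity : B % 2 ≡ yB % 2
      B-parity with parity-agrees CB (low-range B≤K1 B<M)
      ... | inj₁ q = q
      ... | inj₂ (iii , _ , _ , _ , 1<K1 , B≡K1) = ⊥-elim (⊥-by-summing 0
              (≡⇒≥ B≡K1 ⊕ ≡⇒≥ B≡K1 ⊕ B+x≤δ ⊕ B+x≤δ ⊕ K2≤x ⊕ K2≤x ⊕ III-2δ≤ iii ⊕ 1<K1)
              (solve (B ∷ x ∷ δ ∷ K1 ∷ K2 ∷ [])))

      -- An odd perimeter would be < 2 K2 + 2 yB, but it is ≥ 2 yA ≥ 2 (B + x) ≥ 2 yB + 2 K2.
      perimeter-even : (yA + yB + y) % 2 ≡ 0
      perimeter-even with %2-cases (yA + yB + y)
      ... | inj₁ ev = ev
      ... | inj₂ odd = ⊥-elim (too-small (yA ⊓ yB ⊓ y) (≤-trans (m⊓n≤m (yA ⊓ yB) y) (m⊓n≤n yA yB))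
                                         (proj₁ (proj₂ (when-odd P odd))))
        where
        too-small : ∀ m → m ≤ yB → yA + yB + y < 2 * K2 + 2 * m → ⊥
        too-small m m≤yB p< = ⊥-by-summing 0
          (p< ⊕ m≤yB ⊕ m≤yB ⊕ yA≤y+yB ⊕ A≤yA ⊕ A≤yA ⊕ ≡⇒≥ A≡B+x ⊕ ≡⇒≥ A≡B+x ⊕ yB≤B ⊕ yB≤B ⊕ K2≤x ⊕ K2≤x)
          (solve (yA ∷ yB ∷ y ∷ m ∷ A ∷ B ∷ x ∷ K2 ∷ []))

      same-parity : x % 2 ≡ y % 2
      same-parity = even-sum⇒≡%2 x y (begin
        (x + y) % 2            ≡⟨ [k+m+k+n]%2≡[m+n]%2 B x y ⟨
        (B + x + B + y) % 2    ≡⟨ cong (λ t → (t + B + y) % 2) A≡B+x ⟨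
        (A + B + y) % 2        ≡⟨ %2-cong-+ (A + B) (yA + yB) y y (%2-cong-+ A yA B yB A-parity B-parity) refl ⟩
        (yA + yB + y) % 2      ≡⟨ perimeter-even ⟩
        0                      ∎)
        where open ≡-Reasoning

    consistent : Consistent x y
    consistent = record
      { label-pos = 1≤x ; label-≤δ = x≤δ
      ; below-M = λ x<M → ⊥-elim (<-asym x<M M<x)
      ; above-M = λ _ → x≤y
      ; parity-agrees = λ
          { (inj₁ h) → ⊥-elim (<⇒≱ M<x (≤-trans (m≤n⊓o⇒m≤o K1 _ h) (m∸n≤m M 1)))
          ; (inj₂ h) → inj₁ (High.same-parity (m⊔n≤o⇒m≤o K2 _ h)) } }

module Completion (δ K1 K2 C0 C1 M C C′ : ℕ) (C-def : C0 ⊓ C1 ≡ C) (C′-def : C0 ⊔ C1 ≡ C′)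
                  (adm : Admissible δ K1 K2 C0 C1) (mag : MagicParameter δ K1 K2 C0 C1 M)
                  {n : ℕ} (G : LabelledGraph δ n) (d′ : Dist n)
                  (d′∈A : InA δ K1 K2 C0 C1 n d′) (d′-completes : IsCompletion G d′) where

  open Parameters δ K1 K2 C0 C1 M C C′ C-def C′-def adm mag

  d′-refl : ∀ u → d′ u u ≡ 0
  d′-refl = let ((h , _) , _) = d′∈A in h

  d′-pos : ∀ u v → u ≢ v → 1 ≤ d′ u v
  d′-pos u v u≢v with d′ u v in e
  ... | zero  = ⊥-elim (u≢v (let ((_ , h , _) , _) = d′∈A in h u v e))
  ... | suc _ = s≤s z≤n

  d′-sym : ∀ u v → d′ u v ≡ d′ v u
  d′-sym = let ((_ , _ , h , _) , _) = d′∈A in h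

  d′-tri : ∀ u v w → d′ u w ≤ d′ u v + d′ v w
  d′-tri = let ((_ , _ , _ , h , _) , _) = d′∈A in h

  d′≤δ : ∀ u v → d′ u v ≤ δ
  d′≤δ = let ((_ , _ , _ , _ , h) , _) = d′∈A in h

  triangle : ∀ u v w → u ≢ w → w ≢ v → u ≢ v
           → PerimeterCondition (d′ u w + d′ v w + d′ u v) (d′ u w ⊓ d′ v w ⊓ d′ u v)
  triangle u v w u≢w w≢v u≢v =
    subst (λ t → PerimeterCondition (d′ u w + t + d′ u v) (d′ u w ⊓ t ⊓ d′ u v)) (d′-sym w v)
          (perimeter-condition (proj₁ cond) (proj₂ cond))
    where cond = proj₂ d′∈A u w v u≢w w≢v u≢v

  LabelsConsistent : Labelling n → Set
  LabelsConsistent L = ∀ u v {k} → L u v ≡ just k → Consistent k (d′ u v)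

  Loopless : Labelling n → Set
  Loopless L = ∀ u → L u u ≡ nothing

  module _ (L : Labelling n) (consistent-L : LabelsConsistent L) (loopless-L : Loopless L)
           (x : ℕ) (1≤x : 1 ≤ x) (x≤δ : x ≤ δ) (x≢M : x ≢ M) where

    new-label-consistent : ∀ {u v} → NewEdge (FM C M x) L u v → Consistent x (d′ u v)
    new-label-consistent {u} {v} (new-edge w a b uw vw Fpab u≢v) = by-witness (FM-witness C M x a b Fpab)
      where
      u≢w : u ≢ w
      u≢w refl with () ← trans (sym uw) (loopless-L u)
      w≢v : w ≢ v
      w≢v refl with () ← trans (sym vw) (loopless-L w)
      Ca = consistent-L u w uw
      Cb = consistent-L v w vw
      M<x : M ≤ x → M < x
      M<x M≤x = ≤∧≢⇒< M≤x (λ M≡x → x≢M (sym M≡x))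
      by-witness : FMWitness C M x a b → Consistent x (d′ u v)
      by-witness (in-F⁺ x<M a+b≡x) =
        F⁺-step.consistent x a b (d′ u w) (d′ v w) (d′ u v) 1≤x x≤δ x<M a+b≡x Ca Cb
          (subst (λ t → d′ u v ≤ d′ u w + t) (d′-sym w v) (d′-tri u w v)) (triangle u v w u≢w w≢v u≢v)
      by-witness (in-Fᶜ x<M a+b+x+1≡C) =
        Fᶜ-step.consistent x a b (d′ u w) (d′ v w) (d′ u v) 1≤x x≤δ x<M a+b+x+1≡C Ca Cb
          (d′≤δ u w) (d′≤δ v w) (d′-pos u v u≢v) (triangle u v w u≢w w≢v u≢v)
      by-witness (in-F⁻ M≤x a≡b+x) =
        F⁻-step.consistent x a b (d′ u w) (d′ v w) (d′ u v) 1≤x x≤δ (M<x M≤x) a≡b+x Ca Cb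
          (d′-tri u v w) (triangle u v w u≢w w≢v u≢v)
      by-witness (in-F⁻′ M≤x b≡a+x) = subst (Consistent x) (d′-sym v u)
        (F⁻-step.consistent x b a (d′ v w) (d′ u w) (d′ v u) 1≤x x≤δ (M<x M≤x) b≡a+x Cb Ca
          (d′-tri v u w) (triangle v u w (λ e → w≢v (sym e)) (λ e → u≢w (sym e)) (λ e → u≢v (sym e))))

    FCompletion-consistent : LabelsConsistent (FCompletion (FM C M x) x L)
    FCompletion-consistent u v h with FCompletion-just (FM C M x) x L u v h
    ... | inj₁ e            = consistent-L u v e
    ... | inj₂ (refl , new) = new-label-consistent new

  FCompletion-loopless : ∀ (L : Labelling n) Fp c → Loopless L → Loopless (FCompletion Fp c L)
  FCompletion-loopless L Fp c loopless-L u with L u u in e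
  ... | just _ with () ← trans (sym e) (loopless-L u)
  ... | nothing with u F.≟ u
  ...   | yes _   = refl
  ...   | no u≢u = ⊥-elim (u≢u refl)

  step-invariant : ∀ k L → LabelsConsistent L → Loopless L
                 → LabelsConsistent (step δ C M k L) × Loopless (step δ C M k L)
  step-invariant k L consistent-L loopless-L with tMinv δ M k in e
  ... | nothing = consistent-L , loopless-L
  ... | just x with tMinv-sound δ M k e
  ...   | 1≤x , x≤δ , x≢M = FCompletion-consistent L consistent-L loopless-L x 1≤x x≤δ x≢M
                          , FCompletion-loopless L (FM C M x) x loopless-L

  stage-invariant : ∀ j → LabelsConsistent (stage δ C M (lab G) j) × Loopless (stage δ C M (lab G) j)
  stage-invariant zero = edges-consistent , irrefl G
    where
    edges-consistent : LabelsConsistent (lab G)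
    edges-consistent u v e = subst (Consistent _) (sym (d′-completes u v _ e))
                               (consistent-refl (proj₁ (range G u v _ e)) (proj₂ (range G u v _ e)))
  stage-invariant (suc j) = step-invariant (suc j) _ (proj₁ (stage-invariant j)) (proj₂ (stage-invariant j))

  magicCompletion-parity : ∀ u v → ParityRange (magicCompletion C M G u v)
    → magicCompletion C M G u v % 2 ≡ d′ u v % 2 ⊎ Exception (magicCompletion C M G u v)
  magicCompletion-parity u v with u F.≟ v
  ... | yes refl = λ _ → inj₁ (cong (_% 2) (sym (d′-refl u)))
  ... | no _ with stage δ C M (lab G) (2 * δ) u v in e
  ...   | just k  = parity-agrees (proj₁ (stage-invariant (2 * δ)) u v e)
  ...   | nothing = λ
    { (inj₁ h) → ⊥-elim (<⇒≱ (∸-monoʳ-< {M} {1} {0} z<s 1≤M) (m≤n⊓o⇒m≤o K1 _ h))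
    ; (inj₂ h) → ⊥-elim (1+n≰n (m⊔n≤o⇒n≤o K2 _ h)) }

lemma5p12 : (δ K1 K2 C0 C1 M n : ℕ)
    → Admissible δ K1 K2 C0 C1
    → MagicParameter δ K1 K2 C0 C1 M
    → (G : LabelledGraph δ n)
    → Σ (Dist n) (λ d → InA δ K1 K2 C0 C1 n d × IsCompletion G d)
    → (d' : Dist n) → InA δ K1 K2 C0 C1 n d' → IsCompletion G d'
    → (u v : Fin n)
    → (magicCompletion (Cmin C0 C1) M G u v ≤ K1 ⊓ (M ∸ 1)
       ⊎ K2 ⊔ suc M ≤ magicCompletion (Cmin C0 C1) M G u v)
    → (magicCompletion (Cmin C0 C1) M G u v % 2 ≡ d' u v % 2)
      ⊎ (CaseIII δ K1 K2 C0 C1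
         × Cmin C0 C1 ≡ 2 * δ + K1 + 1
         × Cmin C0 C1 ≢ 2 * K1 + 2 * K2 + 1
         × K1 < M × 1 < K1
         × magicCompletion (Cmin C0 C1) M G u v ≡ K1)
lemma5p12 δ K1 K2 C0 C1 M n adm mag G _ d′ d′∈A d′-completes =
  Completion.magicCompletion-parity δ K1 K2 C0 C1 M (Cmin C0 C1) (Cmax C0 C1) refl refl adm mag G d′ d′∈A d′-completes
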